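{- Let $Q$ be a finite set, $\rho:Q\to\mathbb{N}$ with maximum $m$, and let $\mathcal{D}^k$, $\mathcal{L}^k$ be as in the context. For every $0<k\le m$ and every simple type $A$: (0) if $(d_1,d_2),(e_1,e_2)\in\mathcal{L}^k_A$ then $(d_1\vee e_1,d_2\vee e_2)\in\mathcal{L}^k_A$ and $(d_1\wedge e_1,d_2\wedge e_2)\in\mathcal{L}^k_A$ (joins and meets computed pointwise, i.e. by union/intersection at type $o$); (1) if $(d_1,d_2),(e_1,e_2)\in\mathcal{L}^k_A$ and $d_2\le e_2$ then $d_1\le e_1$; (2) for every $d_2\in\mathcal{D}^k_A$ there is a unique $d_1\in\mathcal{D}^{k-1}_A$ with $(d_1,d_2)\in\mathcal{L}^k_A$; (3) if $d_1\le e_1$ in $\mathcal{D}^{k-1}_A$ then (a) there is an element $x\in\mathcal{D}^k_A$ with $(e_1,x)\in\mathcal{L}^k_A$ such that $d_2\le x$ for every $d_2$ with $(d_1,d_2)\in\mathcal{L}^k_A$; and (b) there is an element $y\in\mathcal{D}^k_A$ with $(d_1,y)\in\mathcal{L}^k_A$ such that $y\le e_2$ for every $e_2$ with $(e_1,e_2)\in\mathcal{L}^k_A$.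
   Context: Simple types are built from base type $o$ with $\to$. $Q_k=\{q:\rho(q)=k\}$, $Q_{\le k}=\{q:\rho(q)\le k\}$. Define by induction on $k\le m$ and on types: $\mathcal{D}^0_o=\mathcal{P}(Q_0)$, $\mathcal{D}^0_{A\to B}$ = all monotone maps $\mathcal{D}^0_A\to\mathcal{D}^0_B$; for $k>0$: $\mathcal{D}^k_o=\mathcal{P}(Q_{\le k})$, $\mathcal{L}^k_o=\{(R,P)\in\mathcal{D}^{k-1}_o\times\mathcal{D}^k_o: R=P\cap Q_{\le k-1}\}$, $\mathcal{L}^k_{A\to B}=\{(f_1,f_2): f_1\in\mathcal{D}^{k-1}_{A\to B}$, $f_2$ a monotone map $\mathcal{D}^k_A\to\mathcal{D}^k_B$, such that $(f_1(g_1),f_2(g_2))\in\mathcal{L}^k_B$ for all $(g_1,g_2)\in\mathcal{L}^k_A\}$, and $\mathcal{D}^k_{A\to B}=\{f_2:\exists f_1,(f_1,f_2)\in\mathcal{L}^k_{A\to B}\}$. The order is inclusion on $\mathcal{D}^k_o$ and pointwise on function types. -}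

module Defs where

open import Data.Nat using (ℕ; zero; suc; _≤_)
open import Data.Fin using (Fin)
open import Data.Bool using (Bool; T; _∨_; _∧_)
open import Data.Nat using (_≤ᵇ_)
open import Data.Product using (Σ; _×_)
open import Data.Empty using (⊥)
open import Relation.Binary.PropositionalEquality using (_≡_)

data Ty : Set where
  o   : Ty
  _⇒_ : Ty → Ty → Ty

infixr 20 _⇒_

module _ {n : ℕ} (ρ : Fin n → ℕ) where

  -- Membership in the
  -- domains D^k_A is carved out by the predicate D below; a raw function
  -- represents the map obtained by restricting it to D^k_A.
  Raw : Ty → Set
  Raw o       = Fin n → Bool
  Raw (A ⇒ B) = Raw A → Raw B

  join : (A : Ty) → Raw A → Raw A → Raw A
  join o       s t = λ q → s q ∨ t q
  join (A ⇒ B) f g = λ x → join B (f x) (g x)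

  meet : (A : Ty) → Raw A → Raw A → Raw A
  meet o       s t = λ q → s q ∧ t q
  meet (A ⇒ B) f g = λ x → meet B (f x) (g x)

  mutual
    Le : ℕ → (A : Ty) → Raw A → Raw A → Set
    Le k o       s t = ∀ q → T (s q) → T (t q)
    Le k (A ⇒ B) f g = ∀ x → D k A x → Le k B (f x) (g x)

    Mono : ℕ → (A B : Ty) → Raw (A ⇒ B) → Set
    Mono k A B f =
      (∀ x → D k A x → D k B (f x)) ×
      (∀ x y → D k A x → D k A y → Le k A x y → Le k B (f x) (f y))

    D : ℕ → (A : Ty) → Raw A → Set
    D k       o       s  = ∀ q → T (s q) → ρ q ≤ k
    D zero    (A ⇒ B) f  = Mono zero A B f
    D (suc j) (A ⇒ B) f₂ = Σ (Raw (A ⇒ B)) λ f₁ → L (suc j) (A ⇒ B) f₁ f₂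

    -- the logical relation L^k_A ⊆ D^{k-1}_A × D^k_A (only meaningful for k > 0;
    -- L^0 is set to be empty and is never used)
    L : ℕ → (A : Ty) → Raw A → Raw A → Set
    L zero    A       _  _  = ⊥
    L (suc j) o       r  p  = D j o r × D (suc j) o p × (∀ q → r q ≡ (p q ∧ (ρ q ≤ᵇ j)))
    L (suc j) (A ⇒ B) f₁ f₂ =
      D j (A ⇒ B) f₁ × Mono (suc j) A B f₂ ×
      (∀ g₁ g₂ → L (suc j) A g₁ g₂ → L (suc j) B (f₁ g₁) (f₂ g₂))

  Eq : ℕ → (A : Ty) → Raw A → Raw A → Set
  Eq k A x y = Le k A x y × Le k A y x

-- Fix k = j + 1.  By induction on the type one defines three maps: the
-- restriction  lower : D^k → D^{k-1}  and two liftings  D^{k-1} → D^k,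
-- which at o are  P ↦ P ∩ Q_{≤j},  R ↦ R  and  R ↦ R ∪ Q_k,  and at arrow
-- types are obtained by conjugation:
--   lower f = lower ∘ f ∘ minLift,  minLift f = minLift ∘ f ∘ lower,
--   maxLift f = maxLift ∘ f ∘ lower.
-- Simultaneously one shows that L reflects the order, that (lower p, p) and
-- (r, minLift r), (r, maxLift r) lie in L, and that minLift d₁ / maxLift e₁
-- are the least / greatest partners in (3).  Reflection of the order at
-- A ⇒ B is tested on the related pairs (x, minLift x); uniqueness in (2) is
-- reflection applied in both directions.  Closure under joins and meets is
-- a separate pointwise induction: ∪ and ∩ commute with ∩ Q_{≤j}.
module Submission where

open import Defs
open import Data.Nat using (ℕ; zero; suc; _≤_; _<_; pred; _≤ᵇ_; _≡ᵇ_; _≤?_)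
open import Data.Nat.Properties using (≤ᵇ⇒≤; ≤⇒≤ᵇ; ≡ᵇ⇒≡; ≡⇒≡ᵇ; 1+n≰n; ≰⇒>; n≤1+n; ≤-trans; ≤-antisym; ≤-reflexive)
open import Data.Fin using (Fin)
open import Data.Bool using (true; false; T; _∨_; _∧_)
open import Data.Bool.Properties using (∧-distribʳ-∨; ∧-idem)
open import Data.Product using (Σ; _×_; _,_; proj₁; proj₂)
open import Data.Sum using (_⊎_; inj₁; inj₂; [_,_])
open import Data.Empty using (⊥; ⊥-elim)
open import Data.Unit using (tt)
open import Relation.Nullary using (yes; no)
open import Relation.Binary.PropositionalEquality using (_≡_; refl; sym; trans; cong; cong₂; subst)

T-ext : ∀ a b → (T a → T b) → (T b → T a) → a ≡ b
T-ext false false _ _ = refl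
T-ext false true  _ g = ⊥-elim (g tt)
T-ext true  false f _ = ⊥-elim (f tt)
T-ext true  true  _ _ = refl

T-∧-intro : ∀ a b → T a → T b → T (a ∧ b)
T-∧-intro true b _ t = t

T-∧-elimˡ : ∀ a b → T (a ∧ b) → T a
T-∧-elimˡ true b _ = tt

T-∧-elimʳ : ∀ a b → T (a ∧ b) → T b
T-∧-elimʳ true b t = t

T-∨-elim : ∀ a b → T (a ∨ b) → T a ⊎ T b
T-∨-elim true  b _ = inj₁ tt
T-∨-elim false b t = inj₂ t

T-∨-introˡ : ∀ a b → T a → T (a ∨ b)
T-∨-introˡ true b _ = tt

T-∨-introʳ : ∀ a b → T b → T (a ∨ b)
T-∨-introʳ true  b _ = tt
T-∨-introʳ false b t = t

∧-absorbs-consequence : ∀ a b → (T a → T b) → a ≡ a ∧ b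
∧-absorbs-consequence false b _ = refl
∧-absorbs-consequence true  b f = T-ext true b f (λ _ → tt)

∨-∧-absorbs-disjoint : ∀ a c b → (T a → T b) → (T c → T b → ⊥) → a ≡ (a ∨ c) ∧ b
∨-∧-absorbs-disjoint true  c     b    f _ = ∧-absorbs-consequence true b f
∨-∧-absorbs-disjoint false false b    _ _ = refl
∨-∧-absorbs-disjoint false true  false _ _ = refl
∨-∧-absorbs-disjoint false true  true  _ g = ⊥-elim (g tt tt)

∧-distribʳ-∧ : ∀ x y b → (x ∧ b) ∧ (y ∧ b) ≡ (x ∧ y) ∧ b
∧-distribʳ-∧ false y     b     = refl
∧-distribʳ-∧ true  true  b     = ∧-idem b
∧-distribʳ-∧ true  false true  = refl
∧-distribʳ-∧ true  false false = refl

module _ {n : ℕ} (ρ : Fin n → ℕ) where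

  Le-refl : ∀ k A x → Le ρ k A x x
  Le-refl k o       x q t   = t
  Le-refl k (A ⇒ B) f x _   = Le-refl k B (f x)

  Le-trans : ∀ k A x y z → Le ρ k A x y → Le ρ k A y z → Le ρ k A x z
  Le-trans k o       x y z f g q t = g q (f q t)
  Le-trans k (A ⇒ B) x y z f g a d = Le-trans k B (x a) (y a) (z a) (f a d) (g a d)

  D⇒Mono : ∀ k A B f → D ρ k (A ⇒ B) f → Mono ρ k A B f
  D⇒Mono zero    A B f m             = m
  D⇒Mono (suc j) A B f (_ , _ , m , _) = m

  L⇒D₁ : ∀ j A r p → L ρ (suc j) A r p → D ρ j A r
  L⇒D₁ j o       r p l = proj₁ l
  L⇒D₁ j (A ⇒ B) r p l = proj₁ l

  L⇒D₂ : ∀ j A r p → L ρ (suc j) A r p → D ρ (suc j) A p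
  L⇒D₂ j o       r p l = proj₁ (proj₂ l)
  L⇒D₂ j (A ⇒ B) r p l = r , l

  mutual
    Mono-resp-Eq : ∀ k A B f g → Mono ρ k A B f → Eq ρ k (A ⇒ B) f g → Mono ρ k A B g
    Mono-resp-Eq k A B f g (mD , mLe) (f≤g , g≤f) =
      (λ x dx → D-resp-Eq k B (f x) (g x) (mD x dx) (f≤g x dx , g≤f x dx)) ,
      (λ x y dx dy x≤y → Le-trans k B (g x) (f x) (g y) (g≤f x dx)
          (Le-trans k B (f x) (f y) (g y) (mLe x y dx dy x≤y) (f≤g y dy)))

    D-resp-Eq : ∀ k A x y → D ρ k A x → Eq ρ k A x y → D ρ k A y
    D-resp-Eq k       o       x y d (_ , y≤x) q t = d q (y≤x q t)
    D-resp-Eq zero    (A ⇒ B) f g m e             = Mono-resp-Eq zero A B f g m e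
    D-resp-Eq (suc j) (A ⇒ B) f g (f₁ , l) e      = f₁ , L-respʳ-Eq j (A ⇒ B) f₁ f g l e

    L-respʳ-Eq : ∀ j A r p p′ → L ρ (suc j) A r p → Eq ρ (suc j) A p p′ → L ρ (suc j) A r p′
    L-respʳ-Eq j o r p p′ (dr , dp , h) (p≤p′ , p′≤p) =
      dr , (λ q t → dp q (p′≤p q t)) ,
      λ q → trans (h q) (cong (_∧ (ρ q ≤ᵇ j)) (T-ext (p q) (p′ q) (p≤p′ q) (p′≤p q)))
    L-respʳ-Eq j (A ⇒ B) r p p′ (dr , mp , h) e@(p≤p′ , p′≤p) =
      dr , Mono-resp-Eq (suc j) A B p p′ mp e ,
      λ g₁ g₂ l → let dg₂ = L⇒D₂ j A g₁ g₂ l in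
        L-respʳ-Eq j B (r g₁) (p g₂) (p′ g₂) (h g₁ g₂ l) (p≤p′ g₂ dg₂ , p′≤p g₂ dg₂)

  L-respˡ-Eq : ∀ j A r r′ p → L ρ (suc j) A r p → D ρ j A r′ → Eq ρ j A r r′ → L ρ (suc j) A r′ p
  L-respˡ-Eq j o r r′ p (_ , dp , h) dr′ (r≤r′ , r′≤r) =
    dr′ , dp , λ q → trans (sym (T-ext (r q) (r′ q) (r≤r′ q) (r′≤r q))) (h q)
  L-respˡ-Eq j (A ⇒ B) r r′ p (_ , mp , h) dr′ (r≤r′ , r′≤r) =
    dr′ , mp ,
    λ g₁ g₂ l → let dg₁ = L⇒D₁ j A g₁ g₂ l in
      L-respˡ-Eq j B (r g₁) (r′ g₁) (p g₂) (h g₁ g₂ l)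
        (proj₁ (D⇒Mono j A B r′ dr′) g₁ dg₁) (r≤r′ g₁ dg₁ , r′≤r g₁ dg₁)

  join-mono : ∀ k A a a′ b b′ → Le ρ k A a a′ → Le ρ k A b b′ →
              Le ρ k A (join ρ A a b) (join ρ A a′ b′)
  join-mono k o a a′ b b′ a≤a′ b≤b′ q t =
    [ (λ ta → T-∨-introˡ (a′ q) (b′ q) (a≤a′ q ta)) , (λ tb → T-∨-introʳ (a′ q) (b′ q) (b≤b′ q tb)) ]
      (T-∨-elim (a q) (b q) t)
  join-mono k (A ⇒ B) a a′ b b′ a≤a′ b≤b′ x d =
    join-mono k B (a x) (a′ x) (b x) (b′ x) (a≤a′ x d) (b≤b′ x d)

  meet-mono : ∀ k A a a′ b b′ → Le ρ k A a a′ → Le ρ k A b b′ →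
              Le ρ k A (meet ρ A a b) (meet ρ A a′ b′)
  meet-mono k o a a′ b b′ a≤a′ b≤b′ q t =
    T-∧-intro (a′ q) (b′ q) (a≤a′ q (T-∧-elimˡ (a q) (b q) t)) (b≤b′ q (T-∧-elimʳ (a q) (b q) t))
  meet-mono k (A ⇒ B) a a′ b b′ a≤a′ b≤b′ x d =
    meet-mono k B (a x) (a′ x) (b x) (b′ x) (a≤a′ x d) (b≤b′ x d)

  D-join-o : ∀ k x y → D ρ k o x → D ρ k o y → D ρ k o (join ρ o x y)
  D-join-o k x y dx dy q t = [ dx q , dy q ] (T-∨-elim (x q) (y q) t)

  mutual
    Mono-join : ∀ k A B f g → Mono ρ k A B f → Mono ρ k A B g → Mono ρ k A B (join ρ (A ⇒ B) f g)
    Mono-join k A B f g (fD , fLe) (gD , gLe) =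
      (λ x d → D-join k B (f x) (g x) (fD x d) (gD x d)) ,
      (λ x y dx dy x≤y → join-mono k B (f x) (f y) (g x) (g y) (fLe x y dx dy x≤y) (gLe x y dx dy x≤y))

    D-join : ∀ k A x y → D ρ k A x → D ρ k A y → D ρ k A (join ρ A x y)
    D-join k       o       x y dx dy           = D-join-o k x y dx dy
    D-join zero    (A ⇒ B) f g mf mg           = Mono-join zero A B f g mf mg
    D-join (suc j) (A ⇒ B) f g (f₁ , lf) (g₁ , lg) =
      join ρ (A ⇒ B) f₁ g₁ , L-join j (A ⇒ B) f₁ f g₁ g lf lg

    L-join : ∀ j A d₁ d₂ e₁ e₂ → L ρ (suc j) A d₁ d₂ → L ρ (suc j) A e₁ e₂ →
             L ρ (suc j) A (join ρ A d₁ e₁) (join ρ A d₂ e₂)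
    L-join j o d₁ d₂ e₁ e₂ (dd₁ , dd₂ , hd) (de₁ , de₂ , he) =
      D-join-o j d₁ e₁ dd₁ de₁ , D-join-o (suc j) d₂ e₂ dd₂ de₂ ,
      λ q → trans (cong₂ _∨_ (hd q) (he q)) (sym (∧-distribʳ-∨ (ρ q ≤ᵇ j) (d₂ q) (e₂ q)))
    L-join j (A ⇒ B) d₁ d₂ e₁ e₂ (dd₁ , md₂ , hd) (de₁ , me₂ , he) =
      D-join j (A ⇒ B) d₁ e₁ dd₁ de₁ , Mono-join (suc j) A B d₂ e₂ md₂ me₂ ,
      λ g₁ g₂ l → L-join j B (d₁ g₁) (d₂ g₂) (e₁ g₁) (e₂ g₂) (hd g₁ g₂ l) (he g₁ g₂ l)

  D-meet-o : ∀ k x y → D ρ k o x → D ρ k o y → D ρ k o (meet ρ o x y)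
  D-meet-o k x y dx _ q t = dx q (T-∧-elimˡ (x q) (y q) t)

  mutual
    Mono-meet : ∀ k A B f g → Mono ρ k A B f → Mono ρ k A B g → Mono ρ k A B (meet ρ (A ⇒ B) f g)
    Mono-meet k A B f g (fD , fLe) (gD , gLe) =
      (λ x d → D-meet k B (f x) (g x) (fD x d) (gD x d)) ,
      (λ x y dx dy x≤y → meet-mono k B (f x) (f y) (g x) (g y) (fLe x y dx dy x≤y) (gLe x y dx dy x≤y))

    D-meet : ∀ k A x y → D ρ k A x → D ρ k A y → D ρ k A (meet ρ A x y)
    D-meet k       o       x y dx dy           = D-meet-o k x y dx dy
    D-meet zero    (A ⇒ B) f g mf mg           = Mono-meet zero A B f g mf mg
    D-meet (suc j) (A ⇒ B) f g (f₁ , lf) (g₁ , lg) =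
      meet ρ (A ⇒ B) f₁ g₁ , L-meet j (A ⇒ B) f₁ f g₁ g lf lg

    L-meet : ∀ j A d₁ d₂ e₁ e₂ → L ρ (suc j) A d₁ d₂ → L ρ (suc j) A e₁ e₂ →
             L ρ (suc j) A (meet ρ A d₁ e₁) (meet ρ A d₂ e₂)
    L-meet j o d₁ d₂ e₁ e₂ (dd₁ , dd₂ , hd) (de₁ , de₂ , he) =
      D-meet-o j d₁ e₁ dd₁ de₁ , D-meet-o (suc j) d₂ e₂ dd₂ de₂ ,
      λ q → trans (cong₂ _∧_ (hd q) (he q)) (∧-distribʳ-∧ (d₂ q) (e₂ q) (ρ q ≤ᵇ j))
    L-meet j (A ⇒ B) d₁ d₂ e₁ e₂ (dd₁ , md₂ , hd) (de₁ , me₂ , he) =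
      D-meet j (A ⇒ B) d₁ e₁ dd₁ de₁ , Mono-meet (suc j) A B d₂ e₂ md₂ me₂ ,
      λ g₁ g₂ l → L-meet j B (d₁ g₁) (d₂ g₂) (e₁ g₁) (e₂ g₂) (hd g₁ g₂ l) (he g₁ g₂ l)

  module AtLevel (j : ℕ) where

    K : ℕ
    K = suc j

    mutual
      lower : ∀ A → Raw ρ A → Raw ρ A
      lower o       p q = p q ∧ (ρ q ≤ᵇ j)
      lower (A ⇒ B) f g = lower B (f (minLift A g))

      minLift : ∀ A → Raw ρ A → Raw ρ A
      minLift o       r   = r
      minLift (A ⇒ B) f g = minLift B (f (lower A g))

    maxLift : ∀ A → Raw ρ A → Raw ρ A
    maxLift o       r q = r q ∨ (ρ q ≡ᵇ K)
    maxLift (A ⇒ B) f g = maxLift B (f (lower A g))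

    L-Reflects-Le : Ty → Set
    L-Reflects-Le A = ∀ d₁ d₂ e₁ e₂ → L ρ K A d₁ d₂ → L ρ K A e₁ e₂ → Le ρ K A d₂ e₂ → Le ρ j A d₁ e₁

    L-Related-Lower : Ty → Set
    L-Related-Lower A = ∀ p → D ρ K A p → L ρ K A (lower A p) p

    L-Related-Lift : (A : Ty) → (Raw ρ A → Raw ρ A) → Set
    L-Related-Lift A F = ∀ r → D ρ j A r → L ρ K A r (F r)

    record Lifting (A : Ty) : Set where
      field
        L-reflects-Le    : L-Reflects-Le A
        L-lower          : L-Related-Lower A
        L-minLift        : L-Related-Lift A (minLift A)
        L-maxLift        : L-Related-Lift A (maxLift A)
        minLift-least    : ∀ d₁ e₁ e₂ → Le ρ j A d₁ e₁ → L ρ K A e₁ e₂ → Le ρ K A (minLift A d₁) e₂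
        maxLift-greatest : ∀ d₁ e₁ d₂ → Le ρ j A d₁ e₁ → L ρ K A d₁ d₂ → Le ρ K A d₂ (maxLift A e₁)

      L-unique : ∀ r r′ p → L ρ K A r p → L ρ K A r′ p → Eq ρ j A r r′
      L-unique r r′ p l l′ =
        L-reflects-Le r p r′ p l l′ (Le-refl K A p) , L-reflects-Le r′ p r p l′ l (Le-refl K A p)

      D-lower : ∀ p → D ρ K A p → D ρ j A (lower A p)
      D-lower p dp = L⇒D₁ j A _ p (L-lower p dp)

    open Lifting

    ρ≡K-incompatible-ρ≤j : ∀ q → T (ρ q ≡ᵇ K) → T (ρ q ≤ᵇ j) → ⊥
    ρ≡K-incompatible-ρ≤j q t u = 1+n≰n (subst (_≤ j) (≡ᵇ⇒≡ (ρ q) K t) (≤ᵇ⇒≤ (ρ q) j u))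

    lifting-o : Lifting o
    lifting-o .L-reflects-Le d₁ d₂ e₁ e₂ (_ , _ , hd) (_ , _ , he) d₂≤e₂ q t =
      let t′ = subst T (hd q) t in
      subst T (sym (he q)) (T-∧-intro (e₂ q) _ (d₂≤e₂ q (T-∧-elimˡ (d₂ q) _ t′)) (T-∧-elimʳ (d₂ q) _ t′))
    lifting-o .L-lower p dp = (λ q t → ≤ᵇ⇒≤ (ρ q) j (T-∧-elimʳ (p q) _ t)) , dp , λ q → refl
    lifting-o .L-minLift r dr =
      dr , (λ q t → ≤-trans (dr q t) (n≤1+n j)) ,
      λ q → ∧-absorbs-consequence (r q) (ρ q ≤ᵇ j) (λ t → ≤⇒≤ᵇ (dr q t))
    lifting-o .L-maxLift r dr =
      dr ,
      (λ q t → [ (λ tr → ≤-trans (dr q tr) (n≤1+n j)) , (λ tK → ≤-reflexive (≡ᵇ⇒≡ (ρ q) K tK)) ]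
                 (T-∨-elim (r q) _ t)) ,
      λ q → ∨-∧-absorbs-disjoint (r q) (ρ q ≡ᵇ K) (ρ q ≤ᵇ j) (λ t → ≤⇒≤ᵇ (dr q t)) (ρ≡K-incompatible-ρ≤j q)
    lifting-o .minLift-least d₁ e₁ e₂ d₁≤e₁ (_ , _ , he) q t = T-∧-elimˡ (e₂ q) _ (subst T (he q) (d₁≤e₁ q t))
    lifting-o .maxLift-greatest d₁ e₁ d₂ d₁≤e₁ (_ , dd₂ , hd) q t with ρ q ≤? j
    ... | yes ρq≤j = T-∨-introˡ (e₁ q) _ (d₁≤e₁ q (subst T (sym (hd q)) (T-∧-intro (d₂ q) _ t (≤⇒≤ᵇ ρq≤j))))
    ... | no  ρq≰j = T-∨-introʳ (e₁ q) _ (≡⇒≡ᵇ (ρ q) K (≤-antisym (dd₂ q t) (≰⇒> ρq≰j)))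

    module _ {A B : Ty} (LA : Lifting A) (LB : Lifting B) where

      L-reflects-Le-⇒ : L-Reflects-Le (A ⇒ B)
      L-reflects-Le-⇒ f₁ f₂ e₁ e₂ (_ , _ , hf) (_ , _ , he) f₂≤e₂ x dx =
        let l = L-minLift LA x dx in
        L-reflects-Le LB (f₁ x) (f₂ (minLift A x)) (e₁ x) (e₂ (minLift A x))
          (hf x _ l) (he x _ l) (f₂≤e₂ _ (L⇒D₂ j A x _ l))

      -- f₁ agrees with lower ∘ f₂ ∘ minLift on D^j_A by uniqueness at B.
      L-lower-⇒ : L-Related-Lower (A ⇒ B)
      L-lower-⇒ p (f₁ , lf@(df₁ , mp , h)) =
        L-respˡ-Eq j (A ⇒ B) f₁ (lower (A ⇒ B) p) p lf (D-resp-Eq j (A ⇒ B) f₁ _ df₁ f₁≈) f₁≈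
        where
        f₁≈-at : ∀ x → D ρ j A x → Eq ρ j B (f₁ x) (lower B (p (minLift A x)))
        f₁≈-at x dx = let l = L-minLift LA x dx in
          L-unique LB (f₁ x) _ _ (h x _ l) (L-lower LB _ (proj₁ mp _ (L⇒D₂ j A x _ l)))
        f₁≈ : Eq ρ j (A ⇒ B) f₁ (lower (A ⇒ B) p)
        f₁≈ = (λ x dx → proj₁ (f₁≈-at x dx)) , (λ x dx → proj₂ (f₁≈-at x dx))

      L-conjugate : (F : Raw ρ B → Raw ρ B) → L-Related-Lift B F →
                    (∀ a b → D ρ j B a → D ρ j B b → Le ρ j B a b → Le ρ K B (F a) (F b)) →
                    L-Related-Lift (A ⇒ B) (λ r g → F (r (lower A g)))
      L-conjugate F FL F-mono r dr = dr , (F∘r∘lower-D , F∘r∘lower-mono) , F∘r∘lower-L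
        where
        mr = D⇒Mono j A B r dr
        r∘lower-D : ∀ x → D ρ K A x → D ρ j B (r (lower A x))
        r∘lower-D x dx = proj₁ mr _ (D-lower LA x dx)
        F∘r∘lower-D : ∀ x → D ρ K A x → D ρ K B (F (r (lower A x)))
        F∘r∘lower-D x dx = L⇒D₂ j B _ _ (FL _ (r∘lower-D x dx))
        F∘r∘lower-mono : ∀ x y → D ρ K A x → D ρ K A y → Le ρ K A x y →
                         Le ρ K B (F (r (lower A x))) (F (r (lower A y)))
        F∘r∘lower-mono x y dx dy x≤y =
          F-mono _ _ (r∘lower-D x dx) (r∘lower-D y dy)
            (proj₂ mr _ _ (D-lower LA x dx) (D-lower LA y dy)
              (L-reflects-Le LA _ x _ y (L-lower LA x dx) (L-lower LA y dy) x≤y))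
        F∘r∘lower-L : ∀ g₁ g₂ → L ρ K A g₁ g₂ → L ρ K B (r g₁) (F (r (lower A g₂)))
        F∘r∘lower-L g₁ g₂ l =
          L-respˡ-Eq j B _ (r g₁) _ (FL _ (proj₁ mr _ dlg₂)) (proj₁ mr g₁ dg₁)
            (proj₂ mr _ g₁ dlg₂ dg₁ (proj₁ lg₂≈g₁) , proj₂ mr g₁ _ dg₁ dlg₂ (proj₂ lg₂≈g₁))
          where
          dg₁ = L⇒D₁ j A g₁ g₂ l
          dlg₂ = D-lower LA g₂ (L⇒D₂ j A g₁ g₂ l)
          lg₂≈g₁ = L-unique LA _ g₁ g₂ (L-lower LA g₂ (L⇒D₂ j A g₁ g₂ l)) l

      lifting-⇒ : Lifting (A ⇒ B)
      lifting-⇒ .L-reflects-Le = L-reflects-Le-⇒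
      lifting-⇒ .L-lower       = L-lower-⇒
      lifting-⇒ .L-minLift     =
        L-conjugate (minLift B) (L-minLift LB)
          (λ a b _ db a≤b → minLift-least LB a b _ a≤b (L-minLift LB b db))
      lifting-⇒ .L-maxLift     =
        L-conjugate (maxLift B) (L-maxLift LB)
          (λ a b da _ a≤b → maxLift-greatest LB a b _ a≤b (L-maxLift LB a da))
      lifting-⇒ .minLift-least d₁ e₁ e₂ d₁≤e₁ (_ , _ , he) x dx =
        let lx = L-lower LA x dx in
        minLift-least LB _ _ (e₂ x) (d₁≤e₁ _ (L⇒D₁ j A _ x lx)) (he _ x lx)
      lifting-⇒ .maxLift-greatest d₁ e₁ d₂ d₁≤e₁ (_ , _ , hd) x dx =
        let lx = L-lower LA x dx in
        maxLift-greatest LB _ _ (d₂ x) (d₁≤e₁ _ (L⇒D₁ j A _ x lx)) (hd _ x lx)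

    lifting : ∀ A → Lifting A
    lifting o       = lifting-o
    lifting (A ⇒ B) = lifting-⇒ (lifting A) (lifting B)

lemma4p1 : (n : ℕ) (ρ : Fin n → ℕ) (m : ℕ) →
    Σ (Fin n) (λ q → ρ q ≡ m) → (∀ q → ρ q ≤ m) →
    ∀ k → 0 < k → k ≤ m → ∀ A →
    ((∀ d₁ d₂ e₁ e₂ → L ρ k A d₁ d₂ → L ρ k A e₁ e₂ →
    L ρ k A (join ρ A d₁ e₁) (join ρ A d₂ e₂) ×
    L ρ k A (meet ρ A d₁ e₁) (meet ρ A d₂ e₂))
    × (∀ d₁ d₂ e₁ e₂ → L ρ k A d₁ d₂ → L ρ k A e₁ e₂ →
    Le ρ k A d₂ e₂ → Le ρ (pred k) A d₁ e₁)
    × (∀ d₂ → D ρ k A d₂ →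
    Σ (Raw ρ A) λ d₁ → D ρ (pred k) A d₁ × L ρ k A d₁ d₂ ×
    (∀ d₁′ → D ρ (pred k) A d₁′ → L ρ k A d₁′ d₂ → Eq ρ (pred k) A d₁′ d₁))
    × (∀ d₁ e₁ → D ρ (pred k) A d₁ → D ρ (pred k) A e₁ → Le ρ (pred k) A d₁ e₁ →
    (Σ (Raw ρ A) λ x → D ρ k A x × L ρ k A e₁ x ×
    (∀ d₂ → L ρ k A d₁ d₂ → Le ρ k A d₂ x))
    × (Σ (Raw ρ A) λ y → D ρ k A y × L ρ k A d₁ y ×
    (∀ e₂ → L ρ k A e₁ e₂ → Le ρ k A y e₂))))
lemma4p1 n ρ m _ _ (suc j) _ _ A =
  (λ d₁ d₂ e₁ e₂ l l′ → L-join ρ j A d₁ d₂ e₁ e₂ l l′ , L-meet ρ j A d₁ d₂ e₁ e₂ l l′) ,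
  L-reflects-Le LA ,
  (λ d₂ dd₂ → lower A d₂ , D-lower LA d₂ dd₂ , L-lower LA d₂ dd₂ ,
     λ d₁′ _ l′ → L-unique LA d₁′ _ d₂ l′ (L-lower LA d₂ dd₂)) ,
  (λ d₁ e₁ dd₁ de₁ d₁≤e₁ →
     (maxLift A e₁ , L⇒D₂ ρ j A _ _ (L-maxLift LA e₁ de₁) , L-maxLift LA e₁ de₁ ,
        λ d₂ → maxLift-greatest LA d₁ e₁ d₂ d₁≤e₁) ,
     (minLift A d₁ , L⇒D₂ ρ j A _ _ (L-minLift LA d₁ dd₁) , L-minLift LA d₁ dd₁ ,
        λ e₂ → minLift-least LA d₁ e₁ e₂ d₁≤e₁))
  where
  open AtLevel ρ j
  open Lifting
  LA = lifting A
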